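{- Let $a,k$ be positive integers with $a$ odd. Then for every positive integer $m$, $$t(a,a,2a,4k;\,4m+3a)=4\,t(a,2a,4a,k;\,m).$$
   Context: For positive integers $a,b,c,d$ and an integer $n\ge 0$, $t(a,b,c,d;n)$ denotes the number of $(x,y,z,w)\in\mathbb Z^4$ with $n=a\frac{x(x-1)}2+b\frac{y(y-1)}2+c\frac{z(z-1)}2+d\frac{w(w-1)}2$. -}

module Defs where

open import Data.Nat using (ℕ)
open import Data.Integer using (ℤ; +_; _+_; _-_; _*_; _/_)
open import Data.Product using (Σ; _×_)
open import Data.Fin using (Fin)
open import Function.Bundles using (_↔_)
open import Relation.Binary.PropositionalEquality using (_≡_)

-- triangular-type value x(x-1)/2 for x ∈ ℤ (x(x-1) is always even, so the division is exact)
tri : ℤ → ℤ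
tri x = (x * (x - + 1)) / + 2

Sol : (a b c d n : ℕ) → Set
Sol a b c d n =
  Σ ℤ λ x → Σ ℤ λ y → Σ ℤ λ z → Σ ℤ λ w →
    + n ≡ + a * tri x + + b * tri y + + c * tri z + + d * tri w

-- "t(a,b,c,d;n) = k": the solution set has exactly k elements
HasCount : (a b c d n : ℕ) → ℕ → Set
HasCount a b c d n k = Sol a b c d n ↔ Fin k

-- Write T(x) = x(x-1)/2.  Everything is a change of variables (module ChangeOfVariables):
--  * Pairing: (b, s, u) ↦ (s + u, ρᵇ(s + 1 - u)), where ρ(y) = 1 - y is the reflection
--    fixing T, is a bijection Bool × ℤ² → ℤ² (the bit records the parity of x + y), and
--    T(s + u) + T(s + 1 - u) = s² + 2T(u).
--  * Pairing (z, u) and then (x, y) gives a bijection Bool² × ℤ³ → ℤ³ under which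
--    T(x) + T(y) + 2T(z) = s² + 2σ² + 4T(v).  So for all a, d, n the solutions of
--    n = aT(x) + aT(y) + 2aT(z) + dT(w) are two bits times the solutions of
--    n = a(s² + 2σ² + 4T(v)) + dT(w)  (reflection-bits).
--  * For odd a, d = 4k and n = 4m + 3a, parity forces s and σ to be odd; substituting
--    s = 2q - 1, σ = 2r - 1 and using (2q - 1)² = 8T(q) + 1 turns the reduced equation into
--    m = aT(v) + 2aT(q) + 4aT(r) + kT(w)  (odd-substitution).
module Submission where

open import Defs

module ChangeOfVariables where

  open import Algebra.Properties.AbelianGroup using (∙-cancelʳ)
  open import Axiom.UniquenessOfIdentityProofs using (module Decidable⇒UIP)
  open import Data.Bool using (Bool; true; false)
  open import Data.Empty using (⊥-elim)
  open import Data.Integer using (ℤ; +_; -_; _+_; _-_; _*_; _/_; _%_; ∣_∣)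
  open import Data.Integer.DivMod using (n%d<d; a≡a%n+[a/n]*n)
  open import Data.Integer.Properties
    using (_≟_; *-cancelˡ-≡; abs-*; pos-*; pos-+; +-0-abelianGroup)
  open import Data.Integer.Tactic.RingSolver using (solve-∀)
  import Data.Nat as ℕ
  import Data.Nat.Properties as ℕ
  open import Data.Nat.DivMod using (m≡m%n+[m/n]*n)
  open import Data.Product using (Σ; ∃; _×_; _,_; proj₁; proj₂)
  open import Data.Sum using (_⊎_; inj₁; inj₂)
  open import Function.Bundles using (_↔_; mk⤖)
  open import Function.Consequences.Propositional using (strictlySurjective⇒surjective)
  open import Function.Properties.Bijection using (⤖⇒↔)
  open import Data.Product.Function.NonDependent.Propositional using (_×-↔_)
  open import Function.Properties.Inverse using (↔-refl; ↔-sym; ↔-trans)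
  open import Relation.Binary.PropositionalEquality
    using (_≡_; _≢_; refl; sym; trans; cong; cong₂; module ≡-Reasoning)
  open ≡-Reasoning

  Even Odd : ℤ → Set
  Even x = ∃ λ h → x ≡ + 2 * h
  Odd  x = ∃ λ h → x ≡ + 2 * h + + 1

  halves : ∀ x → x ≡ + 2 * (x / + 2) ⊎ x ≡ + 2 * (x / + 2) + + 1
  halves x with x % + 2 | n%d<d x (+ 2) | a≡a%n+[a/n]*n x (+ 2)
  ... | 0 | _ | x≡ = inj₁ (trans x≡ (even-form (x / + 2)))
    where even-form : ∀ h → + 0 + h * + 2 ≡ + 2 * h
          even-form = solve-∀
  ... | 1 | _ | x≡ = inj₂ (trans x≡ (odd-form (x / + 2)))
    where odd-form : ∀ h → + 1 + h * + 2 ≡ + 2 * h + + 1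
          odd-form = solve-∀
  ... | ℕ.suc (ℕ.suc _) | ℕ.s≤s (ℕ.s≤s ()) | _

  parity : ∀ x → Even x ⊎ Odd x
  parity x with halves x
  ... | inj₁ x≡ = inj₁ (x / + 2 , x≡)
  ... | inj₂ x≡ = inj₂ (x / + 2 , x≡)

  even≢odd : ∀ u v → + 2 * u ≢ + 2 * v + + 1
  even≢odd u v eq = ℕ.even≢odd ∣ u - v ∣ 0 (begin
    2 ℕ.* ∣ u - v ∣              ≡⟨ sym (abs-* (+ 2) (u - v)) ⟩
    ∣ + 2 * (u - v) ∣            ≡⟨ cong ∣_∣ (difference u v) ⟩
    ∣ + 2 * u - + 2 * v ∣        ≡⟨ cong (λ e → ∣ e - + 2 * v ∣) eq ⟩
    ∣ + 2 * v + + 1 - + 2 * v ∣  ≡⟨ cong ∣_∣ (cancel v) ⟩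
    1                            ∎)
    where difference : ∀ u v → + 2 * (u - v) ≡ + 2 * u - + 2 * v
          difference = solve-∀
          cancel : ∀ v → + 2 * v + + 1 - + 2 * v ≡ + 1
          cancel = solve-∀

  halve : ∀ {u v} → + 2 * u ≡ + 2 * v → u ≡ v
  halve {u} {v} = *-cancelˡ-≡ (+ 2) u v

  4u≢4v+2 : ∀ u v → + 4 * u ≢ + 4 * v + + 2
  4u≢4v+2 u v eq = even≢odd u v (halve (begin
    + 2 * (+ 2 * u)        ≡⟨ quadruple u ⟩
    + 4 * u                ≡⟨ eq ⟩
    + 4 * v + + 2          ≡⟨ shifted v ⟩
    + 2 * (+ 2 * v + + 1)  ∎))
    where quadruple : ∀ u → + 2 * (+ 2 * u) ≡ + 4 * u
          quadruple = solve-∀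
          shifted : ∀ v → + 4 * v + + 2 ≡ + 2 * (+ 2 * v + + 1)
          shifted = solve-∀

  consecutive-even : ∀ x → Even (x * (x - + 1))
  consecutive-even x with parity x
  ... | inj₁ (h , refl) = h * (+ 2 * h - + 1) , even-case h
    where even-case : ∀ h → + 2 * h * (+ 2 * h - + 1) ≡ + 2 * (h * (+ 2 * h - + 1))
          even-case = solve-∀
  ... | inj₂ (h , refl) = (+ 2 * h + + 1) * h , odd-case h
    where odd-case : ∀ h → (+ 2 * h + + 1) * (+ 2 * h + + 1 - + 1) ≡ + 2 * ((+ 2 * h + + 1) * h)
          odd-case = solve-∀

  double-tri : ∀ x → + 2 * tri x ≡ x * (x - + 1)
  double-tri x with halves (x * (x - + 1)) | consecutive-even x
  ... | inj₁ exact | _ = sym exact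
  ... | inj₂ odd | (h , even) = ⊥-elim (even≢odd h (x * (x - + 1) / + 2) (trans (sym even) odd))

  reflect : ℤ → ℤ
  reflect y = + 1 - y

  tri-reflect : ∀ y → tri (reflect y) ≡ tri y
  tri-reflect y = halve (begin
    + 2 * tri (reflect y)                ≡⟨ double-tri (reflect y) ⟩
    (+ 1 - y) * ((+ 1 - y) - + 1)        ≡⟨ symmetric y ⟩
    y * (y - + 1)                        ≡⟨ sym (double-tri y) ⟩
    + 2 * tri y                          ∎)
    where symmetric : ∀ y → (+ 1 - y) * ((+ 1 - y) - + 1) ≡ y * (y - + 1)
          symmetric = solve-∀

  reflect-injective : ∀ {y y'} → reflect y ≡ reflect y' → y ≡ y'
  reflect-injective {y} {y'} eq = begin
    y                    ≡⟨ involutive y ⟨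
    reflect (reflect y)  ≡⟨ cong reflect eq ⟩
    reflect (reflect y') ≡⟨ involutive y' ⟩
    y'                   ∎
    where involutive : ∀ y → + 1 - (+ 1 - y) ≡ y
          involutive = solve-∀

  reflectIf : Bool → ℤ → ℤ
  reflectIf false y = y
  reflectIf true  y = reflect y

  tri-reflectIf : ∀ b y → tri (reflectIf b y) ≡ tri y
  tri-reflectIf false y = refl
  tri-reflectIf true  y = tri-reflect y

  pair : Bool → ℤ → ℤ → ℤ × ℤ
  pair b s u = s + u , reflectIf b (s + + 1 - u)

  pair-tri : ∀ b s u → tri (s + u) + tri (reflectIf b (s + + 1 - u)) ≡ s * s + + 2 * tri u
  pair-tri b s u = halve (begin
    + 2 * (tri x + tri (reflectIf b y))   ≡⟨ cong (λ t → + 2 * (tri x + t)) (tri-reflectIf b y) ⟩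
    + 2 * (tri x + tri y)                 ≡⟨ distrib (tri x) (tri y) ⟩
    + 2 * tri x + + 2 * tri y             ≡⟨ cong₂ _+_ (double-tri x) (double-tri y) ⟩
    x * (x - + 1) + y * (y - + 1)         ≡⟨ expand s u ⟩
    + 2 * (s * s) + + 2 * (u * (u - + 1)) ≡⟨ cong (λ t → + 2 * (s * s) + + 2 * t) (double-tri u) ⟨
    + 2 * (s * s) + + 2 * (+ 2 * tri u)   ≡⟨ distrib (s * s) (+ 2 * tri u) ⟨
    + 2 * (s * s + + 2 * tri u)           ∎)
    where
      x y : ℤ
      x = s + u
      y = s + + 1 - u
      distrib : ∀ p q → + 2 * (p + q) ≡ + 2 * p + + 2 * q
      distrib = solve-∀
      expand : ∀ s u → (s + u) * (s + u - + 1) + (s + + 1 - u) * (s + + 1 - u - + 1)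
                       ≡ + 2 * (s * s) + + 2 * (u * (u - + 1))
      expand = solve-∀

  pair-sum-odd : ∀ s u → (s + u) + (s + + 1 - u) ≡ + 2 * s + + 1
  pair-sum-odd = solve-∀

  pair-sum-even : ∀ s u → (s + u) + (+ 1 - (s + + 1 - u)) ≡ + 2 * u
  pair-sum-even = solve-∀

  shift-injective : ∀ {s u s' u'} → s + u ≡ s' + u' → s + + 1 - u ≡ s' + + 1 - u' →
                    s ≡ s' × u ≡ u'
  shift-injective {s} {u} {s'} {u'} eq₁ eq₂ = s≡s' , u≡u'
    where
      s≡s' : s ≡ s'
      s≡s' = halve (∙-cancelʳ +-0-abelianGroup (+ 1) (+ 2 * s) (+ 2 * s') (begin
        + 2 * s + + 1                ≡⟨ pair-sum-odd s u ⟨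
        (s + u) + (s + + 1 - u)      ≡⟨ cong₂ _+_ eq₁ eq₂ ⟩
        (s' + u') + (s' + + 1 - u')  ≡⟨ pair-sum-odd s' u' ⟩
        + 2 * s' + + 1               ∎))
      u≡u' : u ≡ u'
      u≡u' = ∙-cancelʳ +-0-abelianGroup s u u' (begin
        u + s    ≡⟨ comm u s ⟩
        s + u    ≡⟨ eq₁ ⟩
        s' + u'  ≡⟨ cong (_+ u') s≡s' ⟨
        s + u'   ≡⟨ comm s u' ⟩
        u' + s   ∎)
        where comm : ∀ p q → p + q ≡ q + p
              comm = solve-∀

  -- The pairing is injective: the parity of x + y recovers the bit.
  pair-injective : ∀ {b s u b' s' u'} → pair b s u ≡ pair b' s' u' →
                   b ≡ b' × s ≡ s' × u ≡ u'
  pair-injective {false} {s} {u} {false} {s'} {u'} eq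
    with shift-injective {s} {u} {s'} {u'} (cong proj₁ eq) (cong proj₂ eq)
  ... | refl , refl = refl , refl , refl
  pair-injective {true} {s} {u} {true} {s'} {u'} eq
    with shift-injective {s} {u} {s'} {u'} (cong proj₁ eq) (reflect-injective (cong proj₂ eq))
  ... | refl , refl = refl , refl , refl
  pair-injective {false} {s} {u} {true} {s'} {u'} eq =
    ⊥-elim (even≢odd u' s (begin
      + 2 * u'                          ≡⟨ pair-sum-even s' u' ⟨
      (s' + u') + reflect (s' + + 1 - u') ≡⟨ cong (λ p → proj₁ p + proj₂ p) eq ⟨
      (s + u) + (s + + 1 - u)           ≡⟨ pair-sum-odd s u ⟩
      + 2 * s + + 1                     ∎))
  pair-injective {true} {s} {u} {false} {s'} {u'} eq =
    ⊥-elim (even≢odd u s' (begin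
      + 2 * u                           ≡⟨ pair-sum-even s u ⟨
      (s + u) + reflect (s + + 1 - u)   ≡⟨ cong (λ p → proj₁ p + proj₂ p) eq ⟩
      (s' + u') + (s' + + 1 - u')       ≡⟨ pair-sum-odd s' u' ⟩
      + 2 * s' + + 1                    ∎))

  pair-surjective : ∀ x y → Σ Bool λ b → Σ ℤ λ s → Σ ℤ λ u → pair b s u ≡ (x , y)
  pair-surjective x y with parity (x + y)
  ... | inj₂ (h , sum≡) = false , h , x - h , cong₂ _,_ (first x h) (begin
    h + + 1 - (x - h)  ≡⟨ second x h ⟩
    + 2 * h + + 1 - x  ≡⟨ cong (_- x) sum≡ ⟨
    x + y - x          ≡⟨ cancel x y ⟩
    y                  ∎)
    where first : ∀ x h → h + (x - h) ≡ x
          first = solve-∀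
          second : ∀ x h → h + + 1 - (x - h) ≡ + 2 * h + + 1 - x
          second = solve-∀
          cancel : ∀ x y → x + y - x ≡ y
          cancel = solve-∀
  ... | inj₁ (h , sum≡) = true , x - h , h , cong₂ _,_ (first x h) (begin
    + 1 - (x - h + + 1 - h)  ≡⟨ second x h ⟩
    + 2 * h - x              ≡⟨ cong (_- x) sum≡ ⟨
    x + y - x                ≡⟨ cancel x y ⟩
    y                        ∎)
    where first : ∀ x h → x - h + h ≡ x
          first = solve-∀
          second : ∀ x h → + 1 - (x - h + + 1 - h) ≡ + 2 * h - x
          second = solve-∀
          cancel : ∀ x y → x + y - x ≡ y
          cancel = solve-∀

  ternary : ℤ × ℤ × ℤ → ℤ
  ternary (x , y , z) = tri x + tri y + + 2 * tri z

  reducedForm : ℤ → ℤ → ℤ → ℤ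
  reducedForm s σ v = s * s + + 2 * (σ * σ) + + 4 * tri v

  embed : Bool → Bool → ℤ → ℤ → ℤ → ℤ × ℤ × ℤ
  embed b₁ b₂ s σ v = proj₁ xy , proj₂ xy , proj₁ zu
    where
      zu xy : ℤ × ℤ
      zu = pair b₂ σ v
      xy = pair b₁ s (proj₂ zu)

  embed-form : ∀ b₁ b₂ s σ v → ternary (embed b₁ b₂ s σ v) ≡ reducedForm s σ v
  embed-form b₁ b₂ s σ v = begin
    tri x + tri y + + 2 * tri z             ≡⟨ cong (_+ + 2 * tri z) (pair-tri b₁ s u) ⟩
    s * s + + 2 * tri u + + 2 * tri z       ≡⟨ regroup (s * s) (tri u) (tri z) ⟩
    s * s + + 2 * (tri z + tri u)           ≡⟨ cong (λ t → s * s + + 2 * t) (pair-tri b₂ σ v) ⟩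
    s * s + + 2 * (σ * σ + + 2 * tri v)     ≡⟨ expand (s * s) (σ * σ) (tri v) ⟩
    s * s + + 2 * (σ * σ) + + 4 * tri v     ∎
    where
      x y z u : ℤ
      z = σ + v
      u = reflectIf b₂ (σ + + 1 - v)
      x = s + u
      y = reflectIf b₁ (s + + 1 - u)
      regroup : ∀ p q r → p + + 2 * q + + 2 * r ≡ p + + 2 * (r + q)
      regroup = solve-∀
      expand : ∀ p q r → p + + 2 * (q + + 2 * r) ≡ p + + 2 * q + + 4 * r
      expand = solve-∀

  embed-injective : ∀ {b₁ b₂ s σ v b₁' b₂' s' σ' v'} →
                    embed b₁ b₂ s σ v ≡ embed b₁' b₂' s' σ' v' →
                    (b₁ , b₂) ≡ (b₁' , b₂') × (s , σ , v) ≡ (s' , σ' , v')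
  embed-injective {b₁} {b₂} {s} {σ} {v} {b₁'} {b₂'} {s'} {σ'} {v'} eq
    with pair-injective {b₁} {s} {proj₂ (pair b₂ σ v)} {b₁'} {s'} {proj₂ (pair b₂' σ' v')}
           (cong (λ t → proj₁ t , proj₁ (proj₂ t)) eq)
  ... | refl , refl , u≡u'
    with pair-injective {b₂} {σ} {v} {b₂'} {σ'} {v'} (cong₂ _,_ (cong (λ t → proj₂ (proj₂ t)) eq) u≡u')
  ... | refl , refl , refl = refl , refl

  embed-surjective : ∀ x y z → Σ Bool λ b₁ → Σ Bool λ b₂ → Σ ℤ λ s → Σ ℤ λ σ → Σ ℤ λ v →
                     embed b₁ b₂ s σ v ≡ (x , y , z)
  embed-surjective x y z with pair-surjective x y
  ... | b₁ , s , u , refl with pair-surjective z u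
  ...   | b₂ , σ , v , refl = b₁ , b₂ , s , σ , v , refl

  Solutions : (ℤ → ℤ → ℤ → ℤ → ℤ) → ℤ → Set
  Solutions F n = Σ ℤ λ x → Σ ℤ λ y → Σ ℤ λ z → Σ ℤ λ w → n ≡ F x y z w

  coordinates : ∀ {F n} → Solutions F n → ℤ × ℤ × ℤ × ℤ
  coordinates (x , y , z , w , _) = x , y , z , w

  solution-≡ : ∀ {F n} {p q : Solutions F n} → coordinates p ≡ coordinates q → p ≡ q
  solution-≡ {p = x , y , z , w , e} {q = _ , _ , _ , _ , e'} refl =
    cong (λ e → x , y , z , w , e) (Decidable⇒UIP.≡-irrelevant _≟_ e e')

  bijection : ∀ {A B : Set} (f : A → B) → (∀ {p q} → f p ≡ f q → p ≡ q) →
              (∀ r → ∃ λ p → f p ≡ r) → A ↔ B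
  bijection f injective surjective =
    ⤖⇒↔ (mk⤖ (injective , strictlySurjective⇒surjective surjective))

  ReducedSol : (a d n : ℕ.ℕ) → Set
  ReducedSol a d n = Solutions (λ s σ v w → + a * reducedForm s σ v + + d * tri w) (+ n)

  ternary-equation : ∀ a d x y z w →
    + a * tri x + + a * tri y + + (2 ℕ.* a) * tri z + + d * tri w ≡ + a * ternary (x , y , z) + + d * tri w
  ternary-equation a d x y z w = begin
    + a * tri x + + a * tri y + + (2 ℕ.* a) * tri z + + d * tri w
      ≡⟨ cong (λ c → + a * tri x + + a * tri y + c * tri z + + d * tri w) (pos-* 2 a) ⟩
    + a * tri x + + a * tri y + + 2 * + a * tri z + + d * tri w
      ≡⟨ factor (+ a) (tri x) (tri y) (tri z) (+ d * tri w) ⟩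
    + a * (tri x + tri y + + 2 * tri z) + + d * tri w
      ∎
    where factor : ∀ A p q r W → A * p + A * q + + 2 * A * r + W ≡ A * (p + q + + 2 * r) + W
          factor = solve-∀

  reflection-bits : ∀ a d n → Sol a a (2 ℕ.* a) d n ↔ ((Bool × Bool) × ReducedSol a d n)
  reflection-bits a d n = ↔-sym (bijection to to-injective to-surjective)
    where
      to : (Bool × Bool) × ReducedSol a d n → Sol a a (2 ℕ.* a) d n
      to ((b₁ , b₂) , s , σ , v , w , e) = proj₁ t , proj₁ (proj₂ t) , proj₂ (proj₂ t) , w ,
        trans e (trans (cong (λ r → + a * r + + d * tri w) (sym (embed-form b₁ b₂ s σ v)))
                       (sym (ternary-equation a d (proj₁ t) (proj₁ (proj₂ t)) (proj₂ (proj₂ t)) w)))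
        where t : ℤ × ℤ × ℤ
              t = embed b₁ b₂ s σ v

      to-injective : ∀ {p q} → to p ≡ to q → p ≡ q
      to-injective {(b₁ , b₂) , s , σ , v , w , _} {(b₁' , b₂') , s' , σ' , v' , w' , _} eq =
        cong₂ _,_ (proj₁ same-parameters)
                  (solution-≡ (cong₂ (λ (s , σ , v) w → s , σ , v , w) (proj₂ same-parameters) w≡))
        where
          same-embedding : embed b₁ b₂ s σ v ≡ embed b₁' b₂' s' σ' v'
          same-embedding = cong (λ t → proj₁ t , proj₁ (proj₂ t) , proj₁ (proj₂ (proj₂ t))) eq
          same-parameters : (b₁ , b₂) ≡ (b₁' , b₂') × (s , σ , v) ≡ (s' , σ' , v')
          same-parameters = embed-injective {b₁} {b₂} {s} {σ} {v} {b₁'} {b₂'} {s'} {σ'} {v'} same-embedding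
          w≡ : w ≡ w'
          w≡ = cong (λ t → proj₁ (proj₂ (proj₂ (proj₂ t)))) eq

      to-surjective : ∀ r → ∃ λ p → to p ≡ r
      to-surjective (x , y , z , w , e) = from-parameters (embed-surjective x y z)
        where
          from-parameters : (Σ Bool λ b₁ → Σ Bool λ b₂ → Σ ℤ λ s → Σ ℤ λ σ → Σ ℤ λ v →
                               embed b₁ b₂ s σ v ≡ (x , y , z)) →
                            ∃ λ p → to p ≡ (x , y , z , w , e)
          from-parameters (b₁ , b₂ , s , σ , v , embeds) =
            ((b₁ , b₂) , s , σ , v , w , reduced) , solution-≡ (cong (λ (x , y , z) → x , y , z , w) embeds)
            where
              reduced : + n ≡ + a * reducedForm s σ v + + d * tri w
              reduced = begin
                + n
                  ≡⟨ e ⟩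
                + a * tri x + + a * tri y + + (2 ℕ.* a) * tri z + + d * tri w
                  ≡⟨ ternary-equation a d x y z w ⟩
                + a * ternary (x , y , z) + + d * tri w
                  ≡⟨ cong (λ t → + a * ternary t + + d * tri w) embeds ⟨
                + a * ternary (embed b₁ b₂ s σ v) + + d * tri w
                  ≡⟨ cong (λ r → + a * r + + d * tri w) (embed-form b₁ b₂ s σ v) ⟩
                + a * reducedForm s σ v + + d * tri w
                  ∎

  odd-square : ∀ q → (+ 2 * q - + 1) * (+ 2 * q - + 1) ≡ + 8 * tri q + + 1
  odd-square q = begin
    (+ 2 * q - + 1) * (+ 2 * q - + 1)  ≡⟨ square q ⟩
    + 4 * (q * (q - + 1)) + + 1        ≡⟨ cong (λ t → + 4 * t + + 1) (double-tri q) ⟨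
    + 4 * (+ 2 * tri q) + + 1          ≡⟨ regroup (tri q) ⟩
    + 8 * tri q + + 1                  ∎
    where square : ∀ q → (+ 2 * q - + 1) * (+ 2 * q - + 1) ≡ + 4 * (q * (q - + 1)) + + 1
          square = solve-∀
          regroup : ∀ t → + 4 * (+ 2 * t) + + 1 ≡ + 8 * t + + 1
          regroup = solve-∀

  odd-injective : ∀ {q q'} → + 2 * q - + 1 ≡ + 2 * q' - + 1 → q ≡ q'
  odd-injective {q} {q'} eq = halve (∙-cancelʳ +-0-abelianGroup (- + 1) (+ 2 * q) (+ 2 * q') eq)

  both-odd : ∀ {A s σ X Y} → Odd A → A * (s * s + + 2 * (σ * σ)) + + 4 * X ≡ + 4 * Y + + 3 * A →
             (∃ λ q → s ≡ + 2 * q - + 1) × (∃ λ r → σ ≡ + 2 * r - + 1)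
  both-odd {A} {s} {σ} {X} {Y} (c , refl) eq with parity s | parity σ
  ... | inj₁ (h , refl) | _ = ⊥-elim (even≢odd U V (begin
    + 2 * U                                                   ≡⟨ even-side c h σ X ⟩
    A * (+ 2 * h * (+ 2 * h) + + 2 * (σ * σ)) + + 4 * X       ≡⟨ eq ⟩
    + 4 * Y + + 3 * A                                         ≡⟨ odd-side c Y ⟩
    + 2 * V + + 1                                             ∎))
    where
      U V : ℤ
      U = A * (+ 2 * (h * h) + σ * σ) + + 2 * X
      V = + 2 * Y + + 3 * c + + 1
      even-side : ∀ c h σ X → + 2 * ((+ 2 * c + + 1) * (+ 2 * (h * h) + σ * σ) + + 2 * X)
                  ≡ (+ 2 * c + + 1) * (+ 2 * h * (+ 2 * h) + + 2 * (σ * σ)) + + 4 * X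
      even-side = solve-∀
      odd-side : ∀ c Y → + 4 * Y + + 3 * (+ 2 * c + + 1) ≡ + 2 * (+ 2 * Y + + 3 * c + + 1) + + 1
      odd-side = solve-∀
  ... | inj₂ (h , refl) | inj₁ (g , refl) = ⊥-elim (4u≢4v+2 U (Y + c)
    (∙-cancelʳ +-0-abelianGroup A (+ 4 * U) (+ 4 * (Y + c) + + 2) (begin
      + 4 * U + A                                                            ≡⟨ odd-even-side c h g X ⟩
      A * ((+ 2 * h + + 1) * (+ 2 * h + + 1) + + 2 * (+ 2 * g * (+ 2 * g))) + + 4 * X ≡⟨ eq ⟩
      + 4 * Y + + 3 * A                                                      ≡⟨ right-side c Y ⟩
      + 4 * (Y + c) + + 2 + A                                                ∎)))
    where
      U : ℤ
      U = A * (h * h + h + + 2 * (g * g)) + X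
      odd-even-side : ∀ c h g X →
        + 4 * ((+ 2 * c + + 1) * (h * h + h + + 2 * (g * g)) + X) + (+ 2 * c + + 1)
        ≡ (+ 2 * c + + 1) * ((+ 2 * h + + 1) * (+ 2 * h + + 1) + + 2 * (+ 2 * g * (+ 2 * g))) + + 4 * X
      odd-even-side = solve-∀
      right-side : ∀ c Y → + 4 * Y + + 3 * (+ 2 * c + + 1) ≡ + 4 * (Y + c) + + 2 + (+ 2 * c + + 1)
      right-side = solve-∀
  ... | inj₂ (h , refl) | inj₂ (g , refl) = (h + + 1 , shift h) , (g + + 1 , shift g)
    where shift : ∀ h → + 2 * h + + 1 ≡ + 2 * (h + + 1) - + 1
          shift = solve-∀

  substitution-identity : ∀ a k p q r w →
    + a * reducedForm (+ 2 * q - + 1) (+ 2 * r - + 1) p + + (4 ℕ.* k) * tri w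
      ≡ + 4 * (+ a * tri p + + (2 ℕ.* a) * tri q + + (4 ℕ.* a) * tri r + + k * tri w) + + 3 * + a
  substitution-identity a k p q r w = begin
    + a * ((+ 2 * q - + 1) * (+ 2 * q - + 1) + + 2 * ((+ 2 * r - + 1) * (+ 2 * r - + 1)) + + 4 * tri p)
      + + (4 ℕ.* k) * tri w
        ≡⟨ cong₂ (λ Q R → + a * (Q + + 2 * R + + 4 * tri p) + + (4 ℕ.* k) * tri w)
                 (odd-square q) (odd-square r) ⟩
    + a * (+ 8 * tri q + + 1 + + 2 * (+ 8 * tri r + + 1) + + 4 * tri p) + + (4 ℕ.* k) * tri w
        ≡⟨ cong (λ K → + a * (+ 8 * tri q + + 1 + + 2 * (+ 8 * tri r + + 1) + + 4 * tri p) + K * tri w)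
                (pos-* 4 k) ⟩
    + a * (+ 8 * tri q + + 1 + + 2 * (+ 8 * tri r + + 1) + + 4 * tri p) + + 4 * + k * tri w
        ≡⟨ expand (+ a) (+ k) (tri p) (tri q) (tri r) (tri w) ⟩
    + 4 * (+ a * tri p + + 2 * + a * tri q + + 4 * + a * tri r + + k * tri w) + + 3 * + a
        ≡⟨ cong₂ (λ B C → + 4 * (+ a * tri p + B * tri q + C * tri r + + k * tri w) + + 3 * + a)
                 (pos-* 2 a) (pos-* 4 a) ⟨
    + 4 * (+ a * tri p + + (2 ℕ.* a) * tri q + + (4 ℕ.* a) * tri r + + k * tri w) + + 3 * + a
        ∎
    where
      expand : ∀ A K P Q R W →
        A * (+ 8 * Q + + 1 + + 2 * (+ 8 * R + + 1) + + 4 * P) + + 4 * K * W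
          ≡ + 4 * (A * P + + 2 * A * Q + + 4 * A * R + K * W) + + 3 * A
      expand = solve-∀

  right-hand-side : ∀ a m → + (4 ℕ.* m ℕ.+ 3 ℕ.* a) ≡ + 4 * + m + + 3 * + a
  right-hand-side a m = trans (pos-+ (4 ℕ.* m) (3 ℕ.* a)) (cong₂ _+_ (pos-* 4 m) (pos-* 3 a))

  lift-equation : ∀ a k m p q r w →
    + m ≡ + a * tri p + + (2 ℕ.* a) * tri q + + (4 ℕ.* a) * tri r + + k * tri w →
    + (4 ℕ.* m ℕ.+ 3 ℕ.* a) ≡ + a * reducedForm (+ 2 * q - + 1) (+ 2 * r - + 1) p + + (4 ℕ.* k) * tri w
  lift-equation a k m p q r w e = begin
    + (4 ℕ.* m ℕ.+ 3 ℕ.* a)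
      ≡⟨ right-hand-side a m ⟩
    + 4 * + m + + 3 * + a
      ≡⟨ cong (λ t → + 4 * t + + 3 * + a) e ⟩
    + 4 * (+ a * tri p + + (2 ℕ.* a) * tri q + + (4 ℕ.* a) * tri r + + k * tri w) + + 3 * + a
      ≡⟨ substitution-identity a k p q r w ⟨
    + a * reducedForm (+ 2 * q - + 1) (+ 2 * r - + 1) p + + (4 ℕ.* k) * tri w
      ∎

  lower-equation : ∀ a k m p q r w →
    + (4 ℕ.* m ℕ.+ 3 ℕ.* a) ≡ + a * reducedForm (+ 2 * q - + 1) (+ 2 * r - + 1) p + + (4 ℕ.* k) * tri w →
    + m ≡ + a * tri p + + (2 ℕ.* a) * tri q + + (4 ℕ.* a) * tri r + + k * tri w
  lower-equation a k m p q r w e =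
    *-cancelˡ-≡ (+ 4) (+ m) G (∙-cancelʳ +-0-abelianGroup (+ 3 * + a) (+ 4 * + m) (+ 4 * G) (begin
      + 4 * + m + + 3 * + a
        ≡⟨ right-hand-side a m ⟨
      + (4 ℕ.* m ℕ.+ 3 ℕ.* a)
        ≡⟨ e ⟩
      + a * reducedForm (+ 2 * q - + 1) (+ 2 * r - + 1) p + + (4 ℕ.* k) * tri w
        ≡⟨ substitution-identity a k p q r w ⟩
      + 4 * G + + 3 * + a
        ∎))
    where G : ℤ
          G = + a * tri p + + (2 ℕ.* a) * tri q + + (4 ℕ.* a) * tri r + + k * tri w

  -- A reduced solution for (4k, 4m + 3a), rearranged into the shape required by both-odd.
  reduced-mod-4 : ∀ a k m s σ v w →
    + (4 ℕ.* m ℕ.+ 3 ℕ.* a) ≡ + a * reducedForm s σ v + + (4 ℕ.* k) * tri w →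
    + a * (s * s + + 2 * (σ * σ)) + + 4 * (+ a * tri v + + k * tri w) ≡ + 4 * + m + + 3 * + a
  reduced-mod-4 a k m s σ v w e = begin
    + a * (s * s + + 2 * (σ * σ)) + + 4 * (+ a * tri v + + k * tri w)
      ≡⟨ regroup (+ a) (+ k) s σ (tri v) (tri w) ⟩
    + a * reducedForm s σ v + + 4 * + k * tri w
      ≡⟨ cong (λ K → + a * reducedForm s σ v + K * tri w) (pos-* 4 k) ⟨
    + a * reducedForm s σ v + + (4 ℕ.* k) * tri w
      ≡⟨ e ⟨
    + (4 ℕ.* m ℕ.+ 3 ℕ.* a)
      ≡⟨ right-hand-side a m ⟩
    + 4 * + m + + 3 * + a
      ∎
    where regroup : ∀ A K s σ V W →
            A * (s * s + + 2 * (σ * σ)) + + 4 * (A * V + K * W)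
              ≡ A * (s * s + + 2 * (σ * σ) + + 4 * V) + + 4 * K * W
          regroup = solve-∀

  odd-substitution : ∀ a k m → Odd (+ a) →
    Sol a (2 ℕ.* a) (4 ℕ.* a) k m ↔ ReducedSol a (4 ℕ.* k) (4 ℕ.* m ℕ.+ 3 ℕ.* a)
  odd-substitution a k m a-odd = bijection to to-injective to-surjective
    where
      to : Sol a (2 ℕ.* a) (4 ℕ.* a) k m → ReducedSol a (4 ℕ.* k) (4 ℕ.* m ℕ.+ 3 ℕ.* a)
      to (p , q , r , w , e) = + 2 * q - + 1 , + 2 * r - + 1 , p , w , lift-equation a k m p q r w e

      to-injective : ∀ {p q} → to p ≡ to q → p ≡ q
      to-injective {p , q , r , w , _} {p' , q' , r' , w' , _} eq = solution-≡
        (cong₂ _,_ (cong (λ t → proj₁ (proj₂ (proj₂ t))) eq)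
        (cong₂ _,_ (odd-injective (cong proj₁ eq))
        (cong₂ _,_ (odd-injective (cong (λ t → proj₁ (proj₂ t)) eq))
                   (cong (λ t → proj₁ (proj₂ (proj₂ (proj₂ t)))) eq))))

      to-surjective : ∀ r → ∃ λ p → to p ≡ r
      to-surjective (s , σ , v , w , e) =
        from-odd (both-odd {+ a} {s} {σ} {+ a * tri v + + k * tri w} {+ m} a-odd
                           (reduced-mod-4 a k m s σ v w e))
        where
          from-odd : (∃ λ q → s ≡ + 2 * q - + 1) × (∃ λ r → σ ≡ + 2 * r - + 1) →
                     ∃ λ p → to p ≡ (s , σ , v , w , e)
          from-odd ((q , s≡) , (r , σ≡)) =
            (v , q , r , w , lower-equation a k m v q r w (trans e substituted)) ,
            solution-≡ (cong₂ (λ s σ → s , σ , v , w) (sym s≡) (sym σ≡))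
            where
              substituted : + a * reducedForm s σ v + + (4 ℕ.* k) * tri w
                            ≡ + a * reducedForm (+ 2 * q - + 1) (+ 2 * r - + 1) v + + (4 ℕ.* k) * tri w
              substituted = cong₂ (λ s σ → + a * reducedForm s σ v + + (4 ℕ.* k) * tri w) s≡ σ≡

  odd-natural : ∀ a → a ℕ.% 2 ≡ 1 → Odd (+ a)
  odd-natural a a%2≡1 = + (a ℕ./ 2) , (begin
    + a                                ≡⟨ cong +_ (m≡m%n+[m/n]*n a 2) ⟩
    + (a ℕ.% 2 ℕ.+ a ℕ./ 2 ℕ.* 2)      ≡⟨ cong (λ t → + (t ℕ.+ a ℕ./ 2 ℕ.* 2)) a%2≡1 ⟩
    + (1 ℕ.+ a ℕ./ 2 ℕ.* 2)            ≡⟨ pos-+ 1 (a ℕ./ 2 ℕ.* 2) ⟩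
    + 1 + + (a ℕ./ 2 ℕ.* 2)            ≡⟨ cong (λ t → + 1 + t) (pos-* (a ℕ./ 2) 2) ⟩
    + 1 + + (a ℕ./ 2) * + 2            ≡⟨ rearrange (+ (a ℕ./ 2)) ⟩
    + 2 * + (a ℕ./ 2) + + 1            ∎)
    where rearrange : ∀ h → + 1 + h * + 2 ≡ + 2 * h + + 1
          rearrange = solve-∀

  correspondence : ∀ a k m → Odd (+ a) →
    Sol a a (2 ℕ.* a) (4 ℕ.* k) (4 ℕ.* m ℕ.+ 3 ℕ.* a) ↔ ((Bool × Bool) × Sol a (2 ℕ.* a) (4 ℕ.* a) k m)
  correspondence a k m a-odd =
    ↔-trans (reflection-bits a (4 ℕ.* k) (4 ℕ.* m ℕ.+ 3 ℕ.* a))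
            (↔-refl ×-↔ ↔-sym (odd-substitution a k m a-odd))

open ChangeOfVariables using (correspondence; odd-natural)
open import Data.Bool using (Bool)
open import Data.Fin using (Fin)
open import Data.Fin.Properties using (*↔×; 2↔Bool)
open import Data.Nat using (ℕ; _+_; _*_; _%_; _≥_)
open import Data.Product using (_×_)
open import Data.Product.Function.NonDependent.Propositional using (_×-↔_)
open import Function.Bundles using (_↔_)
open import Function.Properties.Inverse using (↔-refl; ↔-sym; ↔-trans)
open import Relation.Binary.PropositionalEquality using (_≡_)

four-copies : ∀ j → ((Bool × Bool) × Fin j) ↔ Fin (4 * j)
four-copies j =
  ↔-sym (↔-trans (*↔× {4} {j}) (↔-trans (*↔× {2} {2}) (2↔Bool ×-↔ 2↔Bool) ×-↔ ↔-refl))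

theorem2p6 : (a k m j : ℕ) → a ≥ 1 → a % 2 ≡ 1 → k ≥ 1 → m ≥ 1 →
    HasCount a (2 * a) (4 * a) k m j →
    HasCount a a (2 * a) (4 * k) (4 * m + 3 * a) (4 * j)
theorem2p6 a k m j _ a-odd _ _ count =
  ↔-trans (correspondence a k m (odd-natural a a-odd))
          (↔-trans (↔-refl ×-↔ count) (four-copies j))
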